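{- For every $k\in\mathbb N$: (i) $m(b(a(k)))=b(k)$; (ii) $m(b(b(k)))+1=b(a(k)+1)$; (iii) $m(b(a(k))-1)+1=b(k)$; (iv) $m(b(b(k))-1)+2=b(a(k)+1)$; (v) $m(2a(a(k))+a(k))+3=b(a(k)+1)$; (vi) $m(2a(b(k))+b(k))+2=b(b(k)+1)$.
   Context: Let $\varphi=\frac{1+\sqrt5}{2}$ and $\mathbb N=\{1,2,\dots\}$. For $n\in\mathbb N$, $a(n)=\lfloor n\varphi\rfloor$, $b(n)=\lfloor n\varphi^2\rfloor$, and $m(n)=\lfloor\varphi n\rfloor-n+1$. -}

module Defs where

open import Data.Nat using (ℕ; zero; suc; _+_; _*_; _∸_; _^_; _≤_; _≤?_)
open import Relation.Nullary using (yes; no)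

-- φ = (1 + √5)/2,  φ² = (3 + √5)/2.
-- For naturals m, n:
--   m ≤ n·φ   ⇔  2m − n ≤ n√5  ⇔  (2m ∸ n)² ≤ 5n²
--   m ≤ n·φ²  ⇔  2m − 3n ≤ n√5 ⇔  (2m ∸ 3n)² ≤ 5n²
-- (when 2m − c·n < 0 the truncated subtraction gives 0 and both sides hold).

LeNφ : ℕ → ℕ → Set
LeNφ n m = (2 * m ∸ n) ^ 2 ≤ 5 * n ^ 2

LeNφ² : ℕ → ℕ → Set
LeNφ² n m = (2 * m ∸ 3 * n) ^ 2 ≤ 5 * n ^ 2

-- Largest m ≤ bound with (2m ∸ c·n)² ≤ 5n²  (0 if none); the predicate is
-- downward closed in m, so this is the floor when bound ≥ the real value.
floorSearch : ℕ → ℕ → ℕ → ℕ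
floorSearch c n zero = zero
floorSearch c n (suc m) with (2 * suc m ∸ c * n) ^ 2 ≤? 5 * n ^ 2
... | yes _ = suc m
... | no  _ = floorSearch c n m

-- a(n) = ⌊n φ⌋   (n φ < 2n, so searching up to 2n suffices)
a : ℕ → ℕ
a n = floorSearch 1 n (2 * n)

-- b(n) = ⌊n φ²⌋  (n φ² < 3n)
b : ℕ → ℕ
b n = floorSearch 3 n (3 * n)

-- m(n) = ⌊φ n⌋ − n + 1   (⌊φ n⌋ ≥ n, so truncated subtraction is exact)
m : ℕ → ℕ
m n = a n ∸ n + 1

module Submission where

-- Write y = a n.  Then y = ⌊φ n⌋ means y² − y n − n² < 0 < (y+1)² − (y+1) n − n² (strictly,
-- as φ is irrational).  The map (n, z) ↦ (z, z + n) negates the form z² − z n − n², so it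
-- carries these two bounds to bounds that pin down a at y, y + n, y + 1 and y + n + 1:
-- a (a n) = b n − 1, a (b n) = b n + a n, a (a n + 1) = b n + 1 and a (b n + 1) = a (b n) + 1.
-- With b n = a n + n they give m (a n) = n and m (b n) = a n + 1, and the six identities
-- follow by rewriting.

open import Defs
open import Data.Nat using (ℕ; zero; suc; _+_; _*_; _∸_; _^_; _≤_; _<_; _≥_; _≤?_; z≤n; s≤s; z<s)
open import Data.Nat.Properties
open import Data.Nat.Tactic.RingSolver using (solve)
open import Data.List using (_∷_; [])
open import Data.Sum using (inj₁; inj₂)
open import Data.Product using (_×_; _,_)
open import Data.Nat.Induction using (<-rec)
open import Function using (_∘_; id)
open import Relation.Nullary using (¬_; Dec; yes; no; contradiction)
open import Relation.Binary.PropositionalEquality using (_≡_; refl; sym; trans; cong; cong₂; subst)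
open ≤-Reasoning

FloorPred : ℕ → ℕ → ℕ → Set
FloorPred c n x = (2 * x ∸ c * n) ^ 2 ≤ 5 * n ^ 2

floorPred-downward : ∀ c n {x y} → x ≤ y → FloorPred c n y → FloorPred c n x
floorPred-downward c n x≤y =
  ≤-trans (^-monoˡ-≤ 2 (∸-monoˡ-≤ (c * n) (*-monoʳ-≤ 2 x≤y)))

floorSearch-≤ : ∀ c n B → floorSearch c n B ≤ B
floorSearch-≤ c n zero = z≤n
floorSearch-≤ c n (suc B) with (2 * suc B ∸ c * n) ^ 2 ≤? 5 * n ^ 2
... | yes _ = ≤-refl
... | no  _ = m≤n⇒m≤1+n (floorSearch-≤ c n B)

floorSearch-sound : ∀ c n B → FloorPred c n (floorSearch c n B)
floorSearch-sound c n zero rewrite 0∸n≡0 (c * n) = z≤n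
floorSearch-sound c n (suc B) with (2 * suc B ∸ c * n) ^ 2 ≤? 5 * n ^ 2
... | yes p = p
... | no  _ = floorSearch-sound c n B

floorSearch-maximal : ∀ c n B → ¬ FloorPred c n (suc B) →
                      ¬ FloorPred c n (suc (floorSearch c n B))
floorSearch-maximal c n zero ¬p = ¬p
floorSearch-maximal c n (suc B) ¬p with (2 * suc B ∸ c * n) ^ 2 ≤? 5 * n ^ 2
... | yes _  = ¬p
... | no  ¬q = floorSearch-maximal c n B ¬q

floorSearch-unique : ∀ c n B {z} → z ≤ B → FloorPred c n z → ¬ FloorPred c n (suc z) →
                     floorSearch c n B ≡ z
floorSearch-unique c n zero z≤n _ _ = refl
floorSearch-unique c n (suc B) z≤1+B pz ¬psz with (2 * suc B ∸ c * n) ^ 2 ≤? 5 * n ^ 2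
... | yes p with m≤n⇒m<n∨m≡n z≤1+B
...   | inj₁ z<1+B = contradiction (floorPred-downward c n z<1+B p) ¬psz
...   | inj₂ z≡1+B = sym z≡1+B
floorSearch-unique c n (suc B) z≤1+B pz ¬psz | no ¬p with m≤n⇒m<n∨m≡n z≤1+B
...   | inj₁ (s≤s z≤B) = floorSearch-unique c n B z≤B pz ¬psz
...   | inj₂ refl      = contradiction pz ¬p

infix 4 _≤φ_

-- y ≤ φ n, by the sign of y² − y n − n² (whose positive root in y is φ n)
_≤φ_ : ℕ → ℕ → Set
y ≤φ n = y * y ≤ y * n + n * n

≤⇒≤φ : ∀ {y n} → y ≤ n → y ≤φ n
≤⇒≤φ {y} {n} y≤n = ≤-trans (*-monoʳ-≤ y y≤n) (m≤m+n (y * n) (n * n))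

floorPred-unfold : ∀ n y → FloorPred 1 n y ≡ ((2 * y ∸ n) * (2 * y ∸ n) ≤ 5 * (n * n))
floorPred-unfold n y =
  cong₂ _≤_ (trans (cong (λ m → (2 * y ∸ m) ^ 2) (*-identityˡ n)) (square (2 * y ∸ n)))
            (cong (5 *_) (square n))
  where
  square : ∀ x → x ^ 2 ≡ x * x
  square x = cong (x *_) (*-identityʳ x)

floorPred-identity : ∀ {n y d} → d + n ≡ 2 * y →
  d * d + 4 * (y * n + n * n) ≡ 4 * (y * y) + 5 * (n * n)
floorPred-identity {n} {y} {d} d+n≡2y = begin-equality
  d * d + 4 * (y * n + n * n)           ≡⟨ solve (d ∷ y ∷ n ∷ []) ⟩
  d * d + 2 * n * (2 * y) + 4 * (n * n) ≡⟨ cong (λ m → d * d + 2 * n * m + 4 * (n * n)) d+n≡2y ⟨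
  d * d + 2 * n * (d + n) + 4 * (n * n) ≡⟨ solve (d ∷ n ∷ []) ⟩
  (d + n) * (d + n) + 5 * (n * n)       ≡⟨ cong (λ m → m * m + 5 * (n * n)) d+n≡2y ⟩
  (2 * y) * (2 * y) + 5 * (n * n)       ≡⟨ solve (y ∷ n ∷ []) ⟩
  4 * (y * y) + 5 * (n * n)             ∎

floorPred⇒≤φ : ∀ n y → FloorPred 1 n y → y ≤φ n
floorPred⇒≤φ n y p with n ≤? 2 * y
... | no  n≰2y = ≤⇒≤φ (≤-trans (m≤m+n y (y + 0)) (<⇒≤ (≰⇒> n≰2y)))
... | yes n≤2y = *-cancelˡ-≤ 4 (+-cancelʳ-≤ (5 * (n * n)) _ _ (begin
  4 * (y * y) + 5 * (n * n)         ≡⟨ floorPred-identity {n} {y} (m∸n+n≡m n≤2y) ⟨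
  d * d + 4 * (y * n + n * n)       ≤⟨ +-monoˡ-≤ _ (subst id (floorPred-unfold n y) p) ⟩
  5 * (n * n) + 4 * (y * n + n * n) ≡⟨ +-comm (5 * (n * n)) _ ⟩
  4 * (y * n + n * n) + 5 * (n * n) ∎))
  where d = 2 * y ∸ n

≤φ⇒floorPred : ∀ n y → y ≤φ n → FloorPred 1 n y
≤φ⇒floorPred n y y≤φn = subst id (sym (floorPred-unfold n y)) (helper (n ≤? 2 * y))
  where
  d = 2 * y ∸ n
  helper : Dec (n ≤ 2 * y) → d * d ≤ 5 * (n * n)
  helper (no n≰2y) rewrite m≤n⇒m∸n≡0 (<⇒≤ (≰⇒> n≰2y)) = z≤n
  helper (yes n≤2y) = +-cancelˡ-≤ (4 * (y * n + n * n)) _ _ (begin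
    4 * (y * n + n * n) + d * d       ≡⟨ +-comm _ (d * d) ⟩
    d * d + 4 * (y * n + n * n)       ≡⟨ floorPred-identity {n} {y} (m∸n+n≡m n≤2y) ⟩
    4 * (y * y) + 5 * (n * n)         ≤⟨ +-monoˡ-≤ _ (*-monoʳ-≤ 4 y≤φn) ⟩
    4 * (y * n + n * n) + 5 * (n * n) ∎)

2n+1≰φn : ∀ n → ¬ suc (2 * n) ≤φ n
2n+1≰φn n = <⇒≱ (begin-strict
  suc (2 * n) * n + n * n                         <⟨ m<m+n _ z<s ⟩
  (suc (2 * n) * n + n * n) + suc (n * n + 3 * n) ≡⟨ solve (n ∷ []) ⟩
  suc (2 * n) * suc (2 * n)                       ∎)

2n≰φn : ∀ {n} → 1 ≤ n → ¬ 2 * n ≤φ n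
2n≰φn {n} 1≤n = <⇒≱ (begin-strict
  2 * n * n + n * n               <⟨ m<m+n _ (*-mono-≤ 1≤n 1≤n) ⟩
  (2 * n * n + n * n) + n * n     ≡⟨ solve (n ∷ []) ⟩
  2 * n * (2 * n)                 ∎)

a-≤φ : ∀ n → a n ≤φ n
a-≤φ n = floorPred⇒≤φ n (a n) (floorSearch-sound 1 n (2 * n))

a-maximal : ∀ n → ¬ suc (a n) ≤φ n
a-maximal n p =
  floorSearch-maximal 1 n (2 * n) (2n+1≰φn n ∘ floorPred⇒≤φ n _) (≤φ⇒floorPred n _ p)

≤φ⇒≤2* : ∀ {y n} → y ≤φ n → y ≤ 2 * n
≤φ⇒≤2* {y} {n} p with y ≤? 2 * n
... | yes y≤2n = y≤2n
... | no  y≰2n = contradiction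
  (floorPred⇒≤φ n _ (floorPred-downward 1 n (≰⇒> y≰2n) (≤φ⇒floorPred n y p))) (2n+1≰φn n)

a-unique : ∀ {n y} → y ≤φ n → ¬ suc y ≤φ n → a n ≡ y
a-unique {n} {y} p ¬q =
  floorSearch-unique 1 n (2 * n) (≤φ⇒≤2* p) (≤φ⇒floorPred n y p) (¬q ∘ floorPred⇒≤φ n (suc y))

a≤2* : ∀ n → a n ≤ 2 * n
a≤2* n = floorSearch-≤ 1 n (2 * n)

n≤a : ∀ n → n ≤ a n
n≤a n with n ≤? a n
... | yes n≤a = n≤a
... | no  n≰a = contradiction (≤⇒≤φ (≰⇒> n≰a)) (a-maximal n)

b≡a+n : ∀ n → b n ≡ a n + n
b≡a+n n = floorSearch-unique 3 n (3 * n)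
  (begin a n + n ≤⟨ +-monoˡ-≤ n (a≤2* n) ⟩ 2 * n + n ≡⟨ solve (n ∷ []) ⟩ 3 * n ∎)
  (subst id (sym (shift (a n))) (floorSearch-sound 1 n (2 * n)))
  (a-maximal n ∘ floorPred⇒≤φ n (suc (a n)) ∘ subst id (shift (suc (a n))))
  where
  shift : ∀ x → FloorPred 3 n (x + n) ≡ FloorPred 1 n x
  shift x = cong (λ m → m ^ 2 ≤ 5 * n ^ 2) (begin-equality
    2 * (x + n) ∸ 3 * n               ≡⟨ cong₂ _∸_ 2[x+n]≡2n+2x 3n≡2n+1n ⟩
    (2 * n + 2 * x) ∸ (2 * n + 1 * n) ≡⟨ [m+n]∸[m+o]≡n∸o (2 * n) (2 * x) (1 * n) ⟩
    2 * x ∸ 1 * n                     ∎)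
    where
    2[x+n]≡2n+2x : 2 * (x + n) ≡ 2 * n + 2 * x
    2[x+n]≡2n+2x = solve (x ∷ n ∷ [])
    3n≡2n+1n : 3 * n ≡ 2 * n + 1 * n
    3n≡2n+1n = solve (n ∷ [])

≤⇒<φ : ∀ {y n} → y ≤ n → 1 ≤ n → y * y < y * n + n * n
≤⇒<φ {y} {n} y≤n 1≤n = begin-strict
  y * y          ≤⟨ *-monoʳ-≤ y y≤n ⟩
  y * n          <⟨ m<m+n (y * n) (*-mono-≤ 1≤n 1≤n) ⟩
  y * n + n * n  ∎

golden-descent : ∀ {n j} → (n + j) * (n + j) ≡ (n + j) * n + n * n → n * n ≡ n * j + j * j
golden-descent {n} {j} eq = sym (+-cancelˡ-≡ (n * n + n * j) _ _ (begin-equality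
  (n * n + n * j) + (n * j + j * j) ≡⟨ solve (n ∷ j ∷ []) ⟩
  (n + j) * (n + j)                 ≡⟨ eq ⟩
  (n + j) * n + n * n               ≡⟨ solve (n ∷ j ∷ []) ⟩
  (n * n + n * j) + n * n           ∎))

-- φ is irrational, by the descent (y, n) ↦ (n, y − n).
golden-irrational : ∀ n {y} → y * y ≡ y * n + n * n → n ≡ 0
golden-irrational = <-rec GoldenSquare descent
  where
  GoldenSquare : ℕ → Set
  GoldenSquare n = ∀ {y} → y * y ≡ y * n + n * n → n ≡ 0

  descent : ∀ n → (∀ {j} → j < n → GoldenSquare j) → GoldenSquare n
  descent zero      _  _ = refl
  descent n@(suc _) ih {y} eq with y ≤? n
  ... | yes y≤n = contradiction eq (<⇒≢ (≤⇒<φ y≤n (s≤s z≤n)))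
  ... | no  y≰n = contradiction (≤-reflexive y≡n) y≰n
    where
    j = y ∸ n
    y≡n+j : y ≡ n + j
    y≡n+j = sym (m+[n∸m]≡n (<⇒≤ (≰⇒> y≰n)))
    eq′ : n * n ≡ n * j + j * j
    eq′ = golden-descent {n} {j} (subst (λ z → z * z ≡ z * n + n * n) y≡n+j eq)
    j<n : j < n
    j<n with n ≤? j
    ... | no  n≰j = ≰⇒> n≰j
    ... | yes n≤j = contradiction eq′ (<⇒≢ (≤⇒<φ n≤j (≤-trans (s≤s z≤n) n≤j)))
    y≡n : y ≡ n
    y≡n = trans y≡n+j (trans (cong (n +_) (ih j<n {n} eq′)) (+-identityʳ n))

-- Below n z e (resp. Above n z e) says z² − z n − n² = −e (resp. +e); the sign of this
-- quadratic form is that of z − φ n.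
record Below (n z e : ℕ) : Set where
  constructor below
  field equation : z * z + e ≡ z * n + n * n

record Above (n z e : ℕ) : Set where
  constructor above
  field equation : z * n + n * n + e ≡ z * z

-- (n, z) ↦ (z, z + n) multiplies z − φ n by 1 − φ, a unit of norm −1, so it swaps the sides of φ.
Below⇒Above : ∀ {n z e} → Below n z e → Above z (z + n) e
Below⇒Above {n} {z} {e} (below eq) = above (begin-equality
  (z + n) * z + z * z + e         ≡⟨ solve (n ∷ z ∷ e ∷ []) ⟩
  z * z + z * n + (z * z + e)     ≡⟨ cong (z * z + z * n +_) eq ⟩
  z * z + z * n + (z * n + n * n) ≡⟨ solve (n ∷ z ∷ []) ⟩
  (z + n) * (z + n)               ∎)

Above⇒Below : ∀ {n z e} → Above n z e → Below z (z + n) e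
Above⇒Below {n} {z} {e} (above eq) = below (begin-equality
  (z + n) * (z + n) + e                 ≡⟨ solve (n ∷ z ∷ e ∷ []) ⟩
  (z * n + n * n + e) + (z * z + z * n) ≡⟨ cong (_+ (z * z + z * n)) eq ⟩
  z * z + (z * z + z * n)               ≡⟨ solve (n ∷ z ∷ []) ⟩
  (z + n) * z + z * z                   ∎)

Below⇒≤φ : ∀ {n y e} → Below n y e → y ≤φ n
Below⇒≤φ {n} {y} {e} (below eq) = ≤-trans (m≤m+n (y * y) e) (≤-reflexive eq)

Above⇒≰φ : ∀ {n z E} → Above n z E → 1 ≤ E → ¬ z ≤φ n
Above⇒≰φ {n} {z} {E} (above eq) 1≤E = <⇒≱ (begin-strict
  z * n + n * n       <⟨ m<m+n _ 1≤E ⟩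
  z * n + n * n + E   ≡⟨ eq ⟩
  z * z               ∎)

a-from-below : ∀ {n y e} → Below n y e → e + n ≤ 2 * y → a n ≡ y
a-from-below {n} {y} {e} lower@(below eq) e+n≤2y =
  a-unique {n} {y} (Below⇒≤φ lower) (<⇒≱ (begin-strict
    suc y * n + n * n   ≡⟨ solve (n ∷ y ∷ []) ⟩
    (y * n + n * n) + n ≡⟨ cong (_+ n) eq ⟨
    y * y + e + n       ≡⟨ +-assoc (y * y) e n ⟩
    y * y + (e + n)     ≤⟨ +-monoʳ-≤ (y * y) e+n≤2y ⟩
    y * y + 2 * y       <⟨ n<1+n _ ⟩
    suc (y * y + 2 * y) ≡⟨ solve (y ∷ []) ⟩
    suc y * suc y       ∎))

a-from-above : ∀ {n z E} → Above n z E → 1 ≤ E → E + n < 2 * z → suc (a n) ≡ z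
a-from-above {n} {suc y} {E} upper@(above eq) 1≤E E+n<2z =
  cong suc (a-unique {n} {y} y≤φn (Above⇒≰φ upper 1≤E))
  where
  E+n≤1+2y : E + n ≤ suc (2 * y)
  E+n≤1+2y = ≤-pred (begin-strict
    E + n              <⟨ E+n<2z ⟩
    2 * suc y          ≡⟨ solve (y ∷ []) ⟩
    suc (suc (2 * y))  ∎)

  y≤φn : y ≤φ n
  y≤φn = +-cancelʳ-≤ (suc (2 * y)) _ _ (begin
    y * y + suc (2 * y)           ≡⟨ solve (y ∷ []) ⟩
    suc y * suc y                 ≡⟨ eq ⟨
    suc y * n + n * n + E         ≡⟨ solve (n ∷ y ∷ E ∷ []) ⟩
    (y * n + n * n) + (E + n)     ≤⟨ +-monoʳ-≤ (y * n + n * n) E+n≤1+2y ⟩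
    (y * n + n * n) + suc (2 * y) ∎)

-- The hypotheses say y = ⌊φ n⌋, with e and E measuring how far y and y + 1 are from φ n.
module GoldenFloor {n y e E : ℕ} (lower : Below n y e) (upper : Above n (suc y) E) (1≤E : 1 ≤ E)
  where

  defect+excess : e + E + n ≡ suc (2 * y)
  defect+excess = +-cancelˡ-≡ (y * y + y * n + n * n) _ _ (begin-equality
    y * y + y * n + n * n + (e + E + n)    ≡⟨ solve (n ∷ y ∷ e ∷ E ∷ []) ⟩
    (y * y + e) + (suc y * n + n * n + E) ≡⟨ cong₂ _+_ (Below.equation lower) (Above.equation upper) ⟩
    (y * n + n * n) + suc y * suc y       ≡⟨ solve (n ∷ y ∷ []) ⟩
    y * y + y * n + n * n + suc (2 * y)    ∎)

  e+n≤2y : e + n ≤ 2 * y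
  e+n≤2y = ≤-pred (begin
    suc (e + n)  ≡⟨ solve (n ∷ e ∷ []) ⟩
    e + 1 + n    ≤⟨ +-monoˡ-≤ n (+-monoʳ-≤ e 1≤E) ⟩
    e + E + n    ≡⟨ defect+excess ⟩
    suc (2 * y)  ∎)

  E≤1+2y : E ≤ suc (2 * y)
  E≤1+2y = begin
    E          ≤⟨ m≤m+n E n ⟩
    E + n      ≤⟨ +-monoˡ-≤ n (m≤n+m E e) ⟩
    e + E + n  ≡⟨ defect+excess ⟩
    suc (2 * y) ∎

  y≤2n : y ≤ 2 * n
  y≤2n = ≤φ⇒≤2* (Below⇒≤φ lower)

  y<2n : 1 ≤ n → y < 2 * n
  y<2n 1≤n with m≤n⇒m<n∨m≡n y≤2n
  ... | inj₁ y<2n = y<2n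
  ... | inj₂ y≡2n = contradiction (subst (_≤φ n) y≡2n (Below⇒≤φ lower)) (2n≰φn 1≤n)

  1≤e : 1 ≤ n → 1 ≤ e
  1≤e 1≤n = n≢0⇒n>0 λ e≡0 → <⇒≢ 1≤n (sym (golden-irrational n {y} (begin-equality
    y * y            ≡⟨ +-identityʳ (y * y) ⟨
    y * y + 0        ≡⟨ cong (y * y +_) e≡0 ⟨
    y * y + e        ≡⟨ Below.equation lower ⟩
    y * n + n * n    ∎)))

  floor-of-floor : 1 ≤ n → suc (a y) ≡ y + n
  floor-of-floor 1≤n = a-from-above (Below⇒Above lower) (1≤e 1≤n) (begin-strict
    e + y              <⟨ s≤s (m≤m+n (e + y) n) ⟩
    suc (e + y + n)    ≡⟨ solve (n ∷ y ∷ e ∷ []) ⟩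
    (e + n) + suc y    ≤⟨ +-mono-≤ e+n≤2y (y<2n 1≤n) ⟩
    2 * y + 2 * n      ≡⟨ solve (n ∷ y ∷ []) ⟩
    2 * (y + n)        ∎)

  floor-of-sum : a (y + n) ≡ (y + n) + y
  floor-of-sum = a-from-below (Above⇒Below (Below⇒Above lower)) (begin
    e + (y + n)               ≡⟨ solve (n ∷ y ∷ e ∷ []) ⟩
    (e + n) + y               ≤⟨ +-monoˡ-≤ y e+n≤2y ⟩
    2 * y + y                 ≤⟨ m≤m+n (2 * y + y) (y + 2 * n) ⟩
    (2 * y + y) + (y + 2 * n) ≡⟨ solve (n ∷ y ∷ []) ⟩
    2 * ((y + n) + y)         ∎)

  floor-of-suc : a (suc y) ≡ suc y + n
  floor-of-suc = a-from-below (Above⇒Below upper) (begin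
    E + suc y                 ≤⟨ +-monoˡ-≤ (suc y) E≤1+2y ⟩
    suc (2 * y) + suc y       ≤⟨ +-monoʳ-≤ (suc (2 * y)) (s≤s y≤2n) ⟩
    suc (2 * y) + suc (2 * n) ≡⟨ solve (n ∷ y ∷ []) ⟩
    2 * (suc y + n)           ∎)

  floor-of-suc-sum : suc (a (suc y + n)) ≡ (suc y + n) + suc y
  floor-of-suc-sum = a-from-above (Below⇒Above (Above⇒Below upper)) 1≤E (begin-strict
    E + (suc y + n)           ≤⟨ +-monoˡ-≤ (suc y + n) E≤1+2y ⟩
    suc (2 * y) + (suc y + n) <⟨ m<m+n _ z<s ⟩
    suc (2 * y) + (suc y + n) + suc (suc (y + n)) ≡⟨ solve (n ∷ y ∷ []) ⟩
    2 * ((suc y + n) + suc y) ∎)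

defect : ℕ → ℕ
defect n = (a n * n + n * n) ∸ a n * a n

excess : ℕ → ℕ
excess n = suc (a n) * suc (a n) ∸ (suc (a n) * n + n * n)

a-below : ∀ n → Below n (a n) (defect n)
a-below n = below (m+[n∸m]≡n (a-≤φ n))

a-above : ∀ n → Above n (suc (a n)) (excess n)
a-above n = above (m+[n∸m]≡n (<⇒≤ (≰⇒> (a-maximal n))))

1≤excess : ∀ n → 1 ≤ excess n
1≤excess n = m+n≤o⇒m≤o∸n 1 (≰⇒> (a-maximal n))

module FloorOf (n : ℕ) = GoldenFloor (a-below n) (a-above n) (1≤excess n)

1≤a : ∀ {n} → 1 ≤ n → 1 ≤ a n
1≤a {n} 1≤n = ≤-trans 1≤n (n≤a n)

1≤b : ∀ {n} → 1 ≤ n → 1 ≤ b n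
1≤b {n} 1≤n = ≤-trans 1≤n (≤-trans (m≤n+m n (a n)) (≤-reflexive (sym (b≡a+n n))))

a[a[n]]+1≡b[n] : ∀ {n} → 1 ≤ n → a (a n) + 1 ≡ b n
a[a[n]]+1≡b[n] {n} 1≤n = begin-equality
  a (a n) + 1   ≡⟨ +-comm (a (a n)) 1 ⟩
  suc (a (a n)) ≡⟨ FloorOf.floor-of-floor n 1≤n ⟩
  a n + n       ≡⟨ b≡a+n n ⟨
  b n           ∎

a[b[n]]≡b[n]+a[n] : ∀ n → a (b n) ≡ b n + a n
a[b[n]]≡b[n]+a[n] n = subst (λ z → a z ≡ z + a n) (sym (b≡a+n n)) (FloorOf.floor-of-sum n)

a[1+a[n]]≡1+b[n] : ∀ n → a (suc (a n)) ≡ suc (b n)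
a[1+a[n]]≡1+b[n] n = trans (FloorOf.floor-of-suc n) (cong suc (sym (b≡a+n n)))

a[1+b[n]]≡1+a[b[n]] : ∀ n → a (suc (b n)) ≡ suc (a (b n))
a[1+b[n]]≡1+a[b[n]] n = begin-equality
  a (suc (b n))         ≡⟨ cong (a ∘ suc) (b≡a+n n) ⟩
  a (suc (y + n))       ≡⟨ suc-injective (trans (FloorOf.floor-of-suc-sum n) (+-suc (suc y + n) y)) ⟩
  suc (y + n + y)       ≡⟨ cong (λ z → suc (z + y)) (b≡a+n n) ⟨
  suc (b n + a n)       ≡⟨ cong suc (a[b[n]]≡b[n]+a[n] n) ⟨
  suc (a (b n))         ∎
  where y = a n

b[x+1] : ∀ {x z} → a (suc x) ≡ suc z → b (x + 1) ≡ z + x + 2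
b[x+1] {x} {z} a[1+x]≡1+z = begin-equality
  b (x + 1)           ≡⟨ b≡a+n (x + 1) ⟩
  a (x + 1) + (x + 1) ≡⟨ cong (λ w → a w + w) (+-comm x 1) ⟩
  a (suc x) + suc x   ≡⟨ cong (_+ suc x) a[1+x]≡1+z ⟩
  suc z + suc x       ≡⟨ solve (x ∷ z ∷ []) ⟩
  z + x + 2           ∎

b[a[n]+1]≡a[b[n]]+2 : ∀ n → b (a n + 1) ≡ a (b n) + 2
b[a[n]+1]≡a[b[n]]+2 n =
  trans (b[x+1] (a[1+a[n]]≡1+b[n] n)) (cong (_+ 2) (sym (a[b[n]]≡b[n]+a[n] n)))

b[b[n]+1]≡b[b[n]]+2 : ∀ n → b (b n + 1) ≡ b (b n) + 2
b[b[n]+1]≡b[b[n]]+2 n =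
  trans (b[x+1] (a[1+b[n]]≡1+a[b[n]] n)) (cong (_+ 2) (sym (b≡a+n (b n))))

b[a[n]]+1≡a[b[n]] : ∀ {n} → 1 ≤ n → b (a n) + 1 ≡ a (b n)
b[a[n]]+1≡a[b[n]] {n} 1≤n = begin-equality
  b (a n) + 1          ≡⟨ cong (_+ 1) (b≡a+n (a n)) ⟩
  a (a n) + a n + 1    ≡⟨ swap-1 (a (a n)) (a n) ⟩
  a (a n) + 1 + a n    ≡⟨ cong (_+ a n) (a[a[n]]+1≡b[n] 1≤n) ⟩
  b n + a n            ≡⟨ a[b[n]]≡b[n]+a[n] n ⟨
  a (b n)              ∎
  where
  swap-1 : ∀ x y → x + y + 1 ≡ x + 1 + y
  swap-1 x y = solve (x ∷ y ∷ [])

m[a[n]]≡n : ∀ {n} → 1 ≤ n → m (a n) ≡ n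
m[a[n]]≡n {n} 1≤n = begin-equality
  a (a n) ∸ a n + 1   ≡⟨ +-∸-comm 1 (n≤a (a n)) ⟨
  a (a n) + 1 ∸ a n   ≡⟨ cong (_∸ a n) (a[a[n]]+1≡b[n] 1≤n) ⟩
  b n ∸ a n           ≡⟨ cong (_∸ a n) (b≡a+n n) ⟩
  a n + n ∸ a n       ≡⟨ m+n∸m≡n (a n) n ⟩
  n                   ∎

m[b[n]]≡a[n]+1 : ∀ n → m (b n) ≡ a n + 1
m[b[n]]≡a[n]+1 n = begin-equality
  a (b n) ∸ b n + 1       ≡⟨ cong (λ z → z ∸ b n + 1) (a[b[n]]≡b[n]+a[n] n) ⟩
  b n + a n ∸ b n + 1     ≡⟨ cong (_+ 1) (m+n∸m≡n (b n) (a n)) ⟩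
  a n + 1                 ∎

m[b[n]∸1]≡a[n] : ∀ {n} → 1 ≤ n → m (b n ∸ 1) ≡ a n
m[b[n]∸1]≡a[n] {n} 1≤n = begin-equality
  m (b n ∸ 1)           ≡⟨ cong (λ z → m (z ∸ 1)) (a[a[n]]+1≡b[n] 1≤n) ⟨
  m (a (a n) + 1 ∸ 1)   ≡⟨ cong m (m+n∸n≡m (a (a n)) 1) ⟩
  m (a (a n))           ≡⟨ m[a[n]]≡n (1≤a 1≤n) ⟩
  a n                   ∎

m[2a[n]+n]≡b[n] : ∀ {n} → 1 ≤ n → m (2 * a n + n) ≡ b n
m[2a[n]+n]≡b[n] {n} 1≤n = begin-equality
  m (2 * a n + n)       ≡⟨ cong m (regroup (a n) n) ⟩
  m ((a n + n) + a n)   ≡⟨ cong (λ z → m (z + a n)) (b≡a+n n) ⟨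
  m (b n + a n)         ≡⟨ cong m (a[b[n]]≡b[n]+a[n] n) ⟨
  m (a (b n))           ≡⟨ m[a[n]]≡n (1≤b 1≤n) ⟩
  b n                   ∎
  where
  regroup : ∀ y n → 2 * y + n ≡ (y + n) + y
  regroup y n = solve (y ∷ n ∷ [])

lemma5p4 : (k : ℕ) → k ≥ 1 →
      (m (b (a k)) ≡ b k)
    × (m (b (b k)) + 1 ≡ b (a k + 1))
    × (m (b (a k) ∸ 1) + 1 ≡ b k)
    × (m (b (b k) ∸ 1) + 2 ≡ b (a k + 1))
    × (m (2 * a (a k) + a k) + 3 ≡ b (a k + 1))
    × (m (2 * a (b k) + b k) + 2 ≡ b (b k + 1))
lemma5p4 k 1≤k =
    trans (m[b[n]]≡a[n]+1 (a k)) (a[a[n]]+1≡b[n] 1≤k)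
  , trans (cong (_+ 1) (m[b[n]]≡a[n]+1 (b k)))
          (trans (+-assoc (a (b k)) 1 1) (sym (b[a[n]+1]≡a[b[n]]+2 k)))
  , trans (cong (_+ 1) (m[b[n]∸1]≡a[n] (1≤a 1≤k))) (a[a[n]]+1≡b[n] 1≤k)
  , trans (cong (_+ 2) (m[b[n]∸1]≡a[n] (1≤b 1≤k))) (sym (b[a[n]+1]≡a[b[n]]+2 k))
  , (begin-equality
      m (2 * a (a k) + a k) + 3 ≡⟨ cong (_+ 3) (m[2a[n]+n]≡b[n] (1≤a 1≤k)) ⟩
      b (a k) + 3               ≡⟨ +-assoc (b (a k)) 1 2 ⟨
      b (a k) + 1 + 2           ≡⟨ cong (_+ 2) (b[a[n]]+1≡a[b[n]] 1≤k) ⟩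
      a (b k) + 2               ≡⟨ b[a[n]+1]≡a[b[n]]+2 k ⟨
      b (a k + 1)               ∎)
  , trans (cong (_+ 2) (m[2a[n]+n]≡b[n] (1≤b 1≤k))) (sym (b[b[n]+1]≡b[b[n]]+2 k))
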